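{- Let $k\ge4$, $G$, $\mathcal S$, $\mathcal Q$, $\alpha$ and the token assignment be as described in the context. If $S$ is a special $2$-star of $\mathcal S$ and $W$ is a star of $\mathcal S$ associated with $S$, then the vertices of $S$ and $W$ receive in total at least $2\alpha+\frac{2-2\alpha}{k-1}$ token.
   Context: $G=(V,E)$ is a simple undirected graph, $k\ge4$ an integer. A star in $G$ is a subgraph that is a single vertex, a single edge, or a tree with exactly one vertex of degree $\ge2$ and all others of degree $1$; an $\ell$-star has exactly $\ell$ vertices, an $\ell^-$-star at most $\ell$, an $\ell^+$-star at least $\ell$. The center of a star is its vertex of maximum degree (in a $2$-star one vertex is designated as center, arbitrarily but fixed); the others are satellites. We write $v_1$-$v_2\ldots v_\ell$ for the star with center $v_1$ and satellites $v_2,\dots,v_\ell$. A $k^-$-star partition of $G$ is a collection of vertex-disjoint $k^-$-stars covering $V$. Operations on a partition $\mathcal S$ (critical vertices are vertices in a $2$-star of $\mathcal S$ or centers of $3$-stars of $\mathcal S$; separate critical vertices lie in different stars of $\mathcal S$): Op.1: for $\{u,v\}\in E$ with $u$ in a $2$-star and $v$ a satellite of a $4^+$-star centered at $c$, replace $\{c,v\}$ by $\{u,v\}$. Op.2: for a star $v_1$-$v_2\ldots v_\ell$ of $\mathcal S$ ($\ell\in\{2,3,4\}$) and pairwise separate critical vertices $w_1,\dots,w_\ell$ outside it with $\{v_j,w_j\}\in E$, replace its edges by $\{v_j,w_j\}$. Op.3: for a $2$- or $3$-star $S=v_1$-$v_2\ldots v_\ell$ and a $2$-star $W=w_1$-$w_2\neq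 S$ with $w_1,w_2$ adjacent to $v_1$: if $k\ge5$ or $\ell=2$ replace $\{w_1,w_2\}$ by $\{w_1,v_1\},\{w_2,v_1\}$; if $k=4,\ell=3$ and some critical $w_3\notin V(S)\cup V(W)$ is adjacent to $v_j$, $j\in\{2,3\}$, replace $\{w_1,w_2\},\{v_1,v_j\}$ by $\{w_1,v_1\},\{w_2,v_1\},\{w_3,v_j\}$. Standing assumptions: $\mathcal S$ is a $k^-$-star partition of $G$ with the minimum possible number of $1$-stars among all $k^-$-star partitions of $G$ and to which none of Operations 1–3 is applicable (equivalently, a possible output of the paper's algorithm). $\mathcal Q$ is a fixed optimal $k^-$-star partition (minimum number of stars), with a fixed center for each of its $2$-stars. A vertex is a center (satellite) of $\mathcal Q$ if it is the center (a satellite) of some star of $\mathcal Q$; an edge of $\mathcal Q$ is an edge of some star of $\mathcal Q$. "Critical" is with respect to $\mathcal S$. Special stars: a $3$-star $S=v_1$-$v_2v_3$ of $\mathcal S$ is special if there is a $2$-star $W=w_1$-$w_2$ of $\mathcal S$ such that (C1) $v_1$ is a satellite of $\mathcal Q$ and $v_2,v_3$ are centers of $\mathcal Q$, and (C2) there are $v_i,v_j\in V(S)$ with $\{v_i,w_1\}$ and $\{v_j,w_2\}$ edges of $\mathcal Q$. A $2$-star $S=v_1$-$v_2$ of $\mathcal S$ is special if $v_1,v_2$ are both satellites of $\mathcal Q$ and either (C3) $k=4$ and there is a $3$-star of $\mathcal S$ with center $w$ such that $\{v_1,w\},\{v_2,w\}$ are edges of $\mathcal Q$, or (C4) there is a $2$-star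 $W=w_1$-$w_2$ of $\mathcal S$ with $\{v_1,w_1\},\{v_2,w_2\}$ edges of $\mathcal Q$. In these cases the star $W$ (in C1–C2 or C4) or the $3$-star (in C3) is said to be associated with $S$. Let $\alpha=\frac{2k-3}{2k^2-4k+1}$. Tokens: the vertex of each $1$-star of $\mathcal Q$ gets $\alpha$. For a $j$-star $v_1$-$v_2\ldots v_j$ of $\mathcal Q$ with $2\le j\le k$: (1) if $v_1$ is critical, $v_1$ gets $\alpha$ and each $v_i$ ($i\ge2$) gets $\frac{1-\alpha}{j-1}$; (2) if $v_1$ is not critical but some satellite is, each $v_i$ ($i\ge2$) gets $\alpha$ and $v_1$ gets $1-(j-1)\alpha$; (3) if no vertex of it is critical, each vertex gets $\frac1j$. -}

module Defs where

open import Data.Nat as ℕ using (ℕ; zero; suc; _∸_)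
open import Data.Integer using (+_)
open import Data.Rational as ℚ using (ℚ; _/_; 0ℚ; 1ℚ)
open import Data.Fin using (Fin)
open import Data.Fin.Properties using () renaming (_≟_ to _≟ᶠ_)
open import Data.Bool using (Bool; if_then_else_)
open import Data.List using (List; []; _∷_; length; foldr; map; _++_)
open import Data.List.Membership.Propositional using (_∈_; _∉_)
open import Data.List.Relation.Unary.All using (All)
open import Data.List.Relation.Unary.Any as Any using (Any)
open import Data.List.Relation.Unary.AllPairs using (AllPairs)
open import Data.List.Relation.Unary.Unique.Propositional using (Unique)
open import Data.List.Relation.Binary.Pointwise using (Pointwise)
open import Data.Product using (Σ; _×_; ∃; ∃-syntax)
open import Data.Sum using (_⊎_)
open import Relation.Nullary using (¬_; Dec; does; _×-dec_; _⊎-dec_)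
open import Relation.Binary.PropositionalEquality using (_≡_; _≢_)

record Graph (n : ℕ) : Set₁ where
  field
    Adj     : Fin n → Fin n → Set
    sym     : ∀ {u v} → Adj u v → Adj v u
    irrefl  : ∀ {u} → ¬ Adj u u
open Graph public

-- Stars: a designated center and a list of satellites.
-- (For a 2-star the center is the designated one; for 1-stars the
-- single vertex is the center.)

record Star (n : ℕ) : Set where
  constructor _-<_>
  field
    center : Fin n
    sats   : List (Fin n)
open Star public

verts : ∀ {n} → Star n → List (Fin n)
verts T = center T ∷ sats T

size : ∀ {n} → Star n → ℕ
size T = suc (length (sats T))

IsStarIn : ∀ {n} → Graph n → Star n → Set
IsStarIn G T = Unique (sats T) × (center T ∉ sats T) × All (Adj G (center T)) (sats T)

allVerts : ∀ {n} → List (Star n) → List (Fin n)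
allVerts [] = []
allVerts (T ∷ P) = verts T ++ allVerts P

IsPartition : ∀ {n} → Graph n → ℕ → List (Star n) → Set
IsPartition {n} G k P =
  All (λ T → IsStarIn G T × size T ℕ.≤ k) P
  × Unique (allVerts P)
  × (∀ (v : Fin n) → v ∈ allVerts P)

ones : ∀ {n} → List (Star n) → ℕ
ones [] = 0
ones (T ∷ P) with sats T
... | []    = suc (ones P)
... | _ ∷ _ = ones P

MinOnes : ∀ {n} → Graph n → ℕ → List (Star n) → Set
MinOnes G k 𝒮 = ∀ P → IsPartition G k P → ones 𝒮 ℕ.≤ ones P

Optimal : ∀ {n} → Graph n → ℕ → List (Star n) → Set
Optimal G k Q = ∀ P → IsPartition G k P → length Q ℕ.≤ length P

_∈?_ : ∀ {n} (v : Fin n) (xs : List (Fin n)) → Dec (v ∈ xs)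
v ∈? xs = Any.any? (v ≟ᶠ_) xs

CriticalIn : ∀ {n} → Fin n → Star n → Set
CriticalIn v T = (size T ≡ 2 × v ∈ verts T) ⊎ (size T ≡ 3 × center T ≡ v)

Critical : ∀ {n} → List (Star n) → Fin n → Set
Critical 𝒮 v = Any (CriticalIn v) 𝒮

critical? : ∀ {n} (𝒮 : List (Star n)) (v : Fin n) → Dec (Critical 𝒮 v)
critical? 𝒮 v = Any.any? (λ T → ((size T ℕ.≟ 2) ×-dec (v ∈? verts T))
                               ⊎-dec ((size T ℕ.≟ 3) ×-dec (center T ≟ᶠ v))) 𝒮

Separate : ∀ {n} → List (Star n) → Fin n → Fin n → Set
Separate 𝒮 u w = ¬ Any (λ T → u ∈ verts T × w ∈ verts T) 𝒮

Op1Applicable : ∀ {n} → Graph n → List (Star n) → Set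
Op1Applicable G 𝒮 =
  Σ (Star _) λ U → Σ (Star _) λ T → Σ (Fin _) λ u → Σ (Fin _) λ v →
    U ∈ 𝒮 × size U ≡ 2 × u ∈ verts U ×
    T ∈ 𝒮 × 4 ℕ.≤ size T × v ∈ sats T × Adj G u v

Op2Applicable : ∀ {n} → Graph n → List (Star n) → Set
Op2Applicable G 𝒮 =
  Σ (Star _) λ T → Σ (List (Fin _)) λ ws →
    T ∈ 𝒮 × (size T ≡ 2 ⊎ size T ≡ 3 ⊎ size T ≡ 4) ×
    Pointwise (Adj G) (verts T) ws ×
    All (Critical 𝒮) ws × All (_∉ verts T) ws × AllPairs (Separate 𝒮) ws

Op3Applicable : ∀ {n} → Graph n → ℕ → List (Star n) → Set
Op3Applicable G k 𝒮 =
  Σ (Star _) λ T → Σ (Star _) λ W → Σ (Fin _) λ w₂ →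
    T ∈ 𝒮 × (size T ≡ 2 ⊎ size T ≡ 3) ×
    W ∈ 𝒮 × sats W ≡ w₂ ∷ [] × W ≢ T ×
    Adj G (center W) (center T) × Adj G w₂ (center T) ×
    ( (5 ℕ.≤ k ⊎ size T ≡ 2)
    ⊎ (k ≡ 4 × size T ≡ 3 ×
        Σ (Fin _) λ w₃ → Σ (Fin _) λ vⱼ →
          Critical 𝒮 w₃ × w₃ ∉ verts T × w₃ ∉ verts W ×
          vⱼ ∈ sats T × Adj G w₃ vⱼ))

QCenter : ∀ {n} → List (Star n) → Fin n → Set
QCenter Q v = Any (λ T → center T ≡ v) Q

QSatellite : ∀ {n} → List (Star n) → Fin n → Set
QSatellite Q v = Any (λ T → v ∈ sats T) Q

QEdge : ∀ {n} → List (Star n) → Fin n → Fin n → Set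
QEdge Q x y = Any (λ T → (center T ≡ x × y ∈ sats T) ⊎ (center T ≡ y × x ∈ sats T)) Q

Special2WithAssoc : ∀ {n} → ℕ → List (Star n) → List (Star n) → Star n → Star n → Set
Special2WithAssoc k 𝒮 Q S W =
  Σ (Fin _) λ v₂ →
    S ∈ 𝒮 × sats S ≡ v₂ ∷ [] ×
    QSatellite Q (center S) × QSatellite Q v₂ × W ∈ 𝒮 ×
    ( (k ≡ 4 × size W ≡ 3 × QEdge Q (center S) (center W) × QEdge Q v₂ (center W))
    ⊎ (Σ (Fin _) λ w₂ → sats W ≡ w₂ ∷ [] ×
         QEdge Q (center S) (center W) × QEdge Q v₂ w₂) )

-- 1/d (only used with d ≥ 1)
invℕ : ℕ → ℚ
invℕ zero    = 0ℚ
invℕ (suc d) = + 1 / suc d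

fromℕ : ℕ → ℚ
fromℕ m = + m / 1

-- α = (2k-3)/(2k²-4k+1), using 2k²-4k+1 = 2k(k-2)+1 for k ≥ 2
α : ℕ → ℚ
α k = + (2 ℕ.* k ∸ 3) / suc (2 ℕ.* k ℕ.* (k ∸ 2))

tokenStar : ∀ {n} → ℕ → List (Star n) → Star n → Fin n → ℚ
tokenStar k 𝒮 (c -< [] >) v = α k
tokenStar k 𝒮 (c -< s ∷ ss >) v =
  if does (critical? 𝒮 c)
    then (if does (c ≟ᶠ v) then α k else (1ℚ ℚ.- α k) ℚ.* invℕ j₋₁)
    else (if does (Any.any? (critical? 𝒮) (s ∷ ss))
            then (if does (c ≟ᶠ v) then 1ℚ ℚ.- fromℕ j₋₁ ℚ.* α k else α k)
            else invℕ (suc j₋₁))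
  where j₋₁ = length (s ∷ ss)

token : ∀ {n} → ℕ → List (Star n) → List (Star n) → Fin n → ℚ
token k 𝒮 [] v = 0ℚ
token k 𝒮 (T ∷ Q) v = if does (v ∈? verts T) then tokenStar k 𝒮 T v else token k 𝒮 Q v

sumℚ : List ℚ → ℚ
sumℚ = foldr ℚ._+_ 0ℚ

¬Op1 : ∀ {n} → Graph n → List (Star n) → Set
¬Op1 G 𝒮 = ¬ Op1Applicable G 𝒮

¬Op2 : ∀ {n} → Graph n → List (Star n) → Set
¬Op2 G 𝒮 = ¬ Op2Applicable G 𝒮

¬Op3 : ∀ {n} → Graph n → ℕ → List (Star n) → Set
¬Op3 G k 𝒮 = ¬ Op3Applicable G k 𝒮

-- A critical center of a Q-star receives α, and every other vertex receives at
-- least (1 - α)/(k - 1), unless it is a non-critical center of a Q-star with a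
-- critical satellite; the claimed bound is 2α + 2(1 - α)/(k - 1).
-- Under C4 the vertices of S are critical Q-satellites of the two critical
-- vertices of W, which gives the bound exactly.  Under C3 (k = 4) both vertices
-- of S are Q-satellites of the critical center w of W, giving α + 2·4/17, and
-- each satellite u of W receives at least 4/17: otherwise u is the center of a
-- Q-star with a critical satellite x, which lies outside S and W, and
-- Operation 3 applies to W and S with w₃ = x, vⱼ = u.
module Submission where

open import Defs hiding (sym)
open import Data.Nat as ℕ using (ℕ; suc; _≤_; _∸_; s≤s; z≤n)
import Data.Nat.Properties as ℕP
open import Data.Nat.Tactic.RingSolver using (solve-∀)
open import Data.Integer as ℤ using (+_)
import Data.Integer.Properties as ℤP
import Data.Integer.Tactic.RingSolver as ℤSolver
open import Data.Rational as ℚ using (ℚ; _+_; _-_; _*_; 0ℚ; 1ℚ; _/_; toℚᵘ)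
import Data.Rational.Properties as ℚP
import Data.Rational.Solver as QSolver
open import Data.Rational.Unnormalised as ℚᵘ using (mkℚᵘ; *≡*; *≤*)
import Data.Rational.Unnormalised.Properties as ℚᵘP
open import Data.Fin using (Fin)
open import Data.Fin.Properties using () renaming (_≟_ to _≟ᶠ_)
open import Data.List using (List; []; _∷_; _++_; map)
open import Data.List.Membership.Propositional using (_∈_; _∉_; find; lose)
open import Data.List.Membership.Propositional.Properties using (∈-++⁺ˡ; ∈-++⁺ʳ; ∈-++⁻)
import Data.List.Relation.Unary.All as All
open import Data.List.Relation.Unary.AllPairs using (_∷_)
open import Data.List.Relation.Unary.Any as Any using (Any; here; there)
open import Data.List.Relation.Unary.Unique.Propositional using (Unique)
open import Data.Product using (∃-syntax; _×_; _,_; proj₁; proj₂)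
open import Data.Sum using (inj₁; inj₂)
open import Data.Empty using (⊥-elim)
open import Relation.Nullary using (¬_; Dec; yes; no; does)
open import Relation.Nullary.Decidable using (toWitness)
open import Data.Bool using (if_then_else_)
open import Relation.Binary.PropositionalEquality

toℚᵘ-/ : ∀ p q → toℚᵘ (+ p / suc q) ℚᵘ.≃ mkℚᵘ (+ p) q
toℚᵘ-/ p q = ℚP.toℚᵘ-fromℚᵘ (mkℚᵘ (+ p) q)

p/q≤r/s : ∀ p q r s .{{_ : ℕ.NonZero q}} .{{_ : ℕ.NonZero s}} → p ℕ.* s ≤ r ℕ.* q → + p / q ℚ.≤ + r / s
p/q≤r/s p (suc q) r (suc s) ps≤rq = ℚP.toℚᵘ-cancel-≤
  (ℚᵘP.≤-respˡ-≃ (ℚᵘP.≃-sym (toℚᵘ-/ p q)) (ℚᵘP.≤-respʳ-≃ (ℚᵘP.≃-sym (toℚᵘ-/ r s))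
    (*≤* (subst₂ ℤ._≤_ (ℤP.pos-* p (suc s)) (ℤP.pos-* r (suc q)) (ℤ.+≤+ ps≤rq)))))

p/r+q/r≡[p+q]/r : ∀ p q r → + p / suc r + + q / suc r ≡ + (p ℕ.+ q) / suc r
p/r+q/r≡[p+q]/r p q r = ℚP.toℚᵘ-injective (begin
  toℚᵘ (+ p / suc r + + q / suc r)            ≈⟨ ℚP.toℚᵘ-homo-+ (+ p / suc r) (+ q / suc r) ⟩
  toℚᵘ (+ p / suc r) ℚᵘ.+ toℚᵘ (+ q / suc r)  ≈⟨ ℚᵘP.+-cong (toℚᵘ-/ p r) (toℚᵘ-/ q r) ⟩
  mkℚᵘ (+ p) r ℚᵘ.+ mkℚᵘ (+ q) r              ≈⟨ *≡* cross ⟩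
  mkℚᵘ (+ (p ℕ.+ q)) r                        ≈⟨ toℚᵘ-/ (p ℕ.+ q) r ⟨
  toℚᵘ (+ (p ℕ.+ q) / suc r)                  ∎)
  where
  open ℚᵘP.≃-Reasoning
  common : ∀ a b d → (a ℤ.* d ℤ.+ b ℤ.* d) ℤ.* d ≡ (a ℤ.+ b) ℤ.* (d ℤ.* d)
  common = ℤSolver.solve-∀
  cross : (+ p ℤ.* + suc r ℤ.+ + q ℤ.* + suc r) ℤ.* + suc r ≡ + (p ℕ.+ q) ℤ.* + (suc r ℕ.* suc r)
  cross rewrite ℤP.pos-+ p q | ℤP.pos-* (suc r) (suc r) = common (+ p) (+ q) (+ suc r)

p/q*r/s≡pr/qs : ∀ p q r s → + p / suc q * (+ r / suc s) ≡ + (p ℕ.* r) / (suc q ℕ.* suc s)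
p/q*r/s≡pr/qs p q r s = ℚP.toℚᵘ-injective (begin
  toℚᵘ (+ p / suc q * (+ r / suc s))            ≈⟨ ℚP.toℚᵘ-homo-* (+ p / suc q) (+ r / suc s) ⟩
  toℚᵘ (+ p / suc q) ℚᵘ.* toℚᵘ (+ r / suc s)    ≈⟨ ℚᵘP.*-cong (toℚᵘ-/ p q) (toℚᵘ-/ r s) ⟩
  mkℚᵘ (+ p) q ℚᵘ.* mkℚᵘ (+ r) s                ≈⟨ *≡* cross ⟩
  mkℚᵘ (+ (p ℕ.* r)) (s ℕ.+ q ℕ.* suc s)        ≈⟨ toℚᵘ-/ (p ℕ.* r) _ ⟨
  toℚᵘ (+ (p ℕ.* r) / (suc q ℕ.* suc s))        ∎)
  where
  open ℚᵘP.≃-Reasoning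
  cross : (+ p ℤ.* + r) ℤ.* + (suc q ℕ.* suc s) ≡ + (p ℕ.* r) ℤ.* (+ suc q ℤ.* + suc s)
  cross = cong₂ ℤ._*_ (sym (ℤP.pos-* p r)) (ℤP.pos-* (suc q) (suc s))

n/n≡1 : ∀ r → + suc r / suc r ≡ 1ℚ
n/n≡1 r = ℚP.toℚᵘ-injective (ℚᵘP.≃-trans (toℚᵘ-/ (suc r) r)
  (*≡* (trans (ℤP.*-identityʳ (+ suc r)) (sym (ℤP.*-identityˡ (+ suc r))))))

1-p/r≡q/r : ∀ p q r → p ℕ.+ q ≡ suc r → 1ℚ - + p / suc r ≡ + q / suc r
1-p/r≡q/r p q r p+q≡r = begin
  1ℚ - a        ≡⟨ cong (_- a) 1≡a+b ⟩
  (a + b) - a   ≡⟨ cong (_- a) (ℚP.+-comm a b) ⟩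
  (b + a) - a   ≡⟨ ℚP.+-assoc b a (ℚ.- a) ⟩
  b + (a - a)   ≡⟨ cong (λ x → b + x) (ℚP.+-inverseʳ a) ⟩
  b + 0ℚ        ≡⟨ ℚP.+-identityʳ b ⟩
  b             ∎
  where
  open ≡-Reasoning
  a = + p / suc r
  b = + q / suc r
  1≡a+b : 1ℚ ≡ a + b
  1≡a+b = sym (trans (p/r+q/r≡[p+q]/r p q r) (trans (cong (λ n → + n / suc r) p+q≡r) (n/n≡1 r)))

invℕ-antitone : ∀ {i j} → 1 ≤ i → i ≤ j → invℕ j ℚ.≤ invℕ i
invℕ-antitone {suc i} {suc j} _ i≤j =
  p/q≤r/s 1 (suc j) 1 (suc i) (subst₂ _≤_ (sym (ℕP.*-identityˡ (suc i))) (sym (ℕP.*-identityˡ (suc j))) i≤j)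

minToken : ℕ → ℚ
minToken k = (1ℚ - α k) * invℕ (k ∸ 1)

private
  module TwoPlus (m : ℕ) where
    d y : ℕ
    d = 2 ℕ.* (2 ℕ.+ m) ℕ.* m
    y = 2 ℕ.* suc m ℕ.* m

    α≡ : α (2 ℕ.+ m) ≡ + (1 ℕ.+ 2 ℕ.* m) / suc d
    α≡ = cong (λ x → + x / suc d) (trans (cong (_∸ 3) (expand m)) (ℕP.m+n∸m≡n 3 (1 ℕ.+ 2 ℕ.* m)))
      where
      expand : ∀ m → 2 ℕ.* (2 ℕ.+ m) ≡ 3 ℕ.+ (1 ℕ.+ 2 ℕ.* m)
      expand = solve-∀

    1-α≡ : 1ℚ - α (2 ℕ.+ m) ≡ + y / suc d
    1-α≡ = trans (cong (1ℚ -_) α≡) (1-p/r≡q/r (1 ℕ.+ 2 ℕ.* m) y d (split m))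
      where
      split : ∀ m → (1 ℕ.+ 2 ℕ.* m) ℕ.+ 2 ℕ.* suc m ℕ.* m ≡ 1 ℕ.+ 2 ℕ.* (2 ℕ.+ m) ℕ.* m
      split = solve-∀

    minToken≡ : minToken (2 ℕ.+ m) ≡ + (y ℕ.* 1) / (suc d ℕ.* suc m)
    minToken≡ = trans (cong (_* invℕ (suc m)) 1-α≡) (p/q*r/s≡pr/qs y d 1 m)

    minToken≤α : minToken (2 ℕ.+ m) ℚ.≤ α (2 ℕ.+ m)
    minToken≤α = subst₂ ℚ._≤_ (sym minToken≡) (sym α≡)
      (p/q≤r/s (y ℕ.* 1) (suc d ℕ.* suc m) (1 ℕ.+ 2 ℕ.* m) (suc d) (ℕP.≤-trans (ℕP.m≤m+n _ _) (ℕP.≤-reflexive (cross m))))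
      where
      cross : ∀ m → let D = 1 ℕ.+ 2 ℕ.* (2 ℕ.+ m) ℕ.* m in
              2 ℕ.* (1 ℕ.+ m) ℕ.* m ℕ.* 1 ℕ.* D ℕ.+ (1 ℕ.+ m) ℕ.* D ≡ (1 ℕ.+ 2 ℕ.* m) ℕ.* (D ℕ.* (1 ℕ.+ m))
      cross = solve-∀

    minToken≤1/k : minToken (2 ℕ.+ m) ℚ.≤ invℕ (2 ℕ.+ m)
    minToken≤1/k = subst (ℚ._≤ invℕ (2 ℕ.+ m)) (sym minToken≡)
      (p/q≤r/s (y ℕ.* 1) (suc d ℕ.* suc m) 1 (2 ℕ.+ m) (ℕP.≤-trans (ℕP.m≤m+n _ _) (ℕP.≤-reflexive (cross m))))
      where
      cross : ∀ m → let D = 1 ℕ.+ 2 ℕ.* (2 ℕ.+ m) ℕ.* m in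
              2 ℕ.* (1 ℕ.+ m) ℕ.* m ℕ.* 1 ℕ.* (2 ℕ.+ m) ℕ.+ (1 ℕ.+ m) ≡ 1 ℕ.* (D ℕ.* (1 ℕ.+ m))
      cross = solve-∀

1-α-nonNeg : ∀ {k} → 2 ≤ k → ℚ.NonNegative (1ℚ - α k)
1-α-nonNeg (s≤s (s≤s (z≤n {m}))) =
  subst ℚ.NonNegative (sym (TwoPlus.1-α≡ m)) (ℚP.normalize-nonNeg (TwoPlus.y m) (suc (TwoPlus.d m)))

minToken≤α : ∀ {k} → 2 ≤ k → minToken k ℚ.≤ α k
minToken≤α (s≤s (s≤s (z≤n {m}))) = TwoPlus.minToken≤α m

minToken≤1/k : ∀ {k} → 2 ≤ k → minToken k ℚ.≤ invℕ k
minToken≤1/k (s≤s (s≤s (z≤n {m}))) = TwoPlus.minToken≤1/k m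

∈-allVerts⁺ : ∀ {n} {P : List (Star n)} {T x} → T ∈ P → x ∈ verts T → x ∈ allVerts P
∈-allVerts⁺ (here refl) x∈T = ∈-++⁺ˡ x∈T
∈-allVerts⁺ {P = T′ ∷ _} (there T∈P) x∈T = ∈-++⁺ʳ (verts T′) (∈-allVerts⁺ T∈P x∈T)

∈-allVerts⁻ : ∀ {n} (P : List (Star n)) {x} → x ∈ allVerts P → ∃[ T ] (T ∈ P × x ∈ verts T)
∈-allVerts⁻ (T ∷ P) x∈ with ∈-++⁻ (verts T) x∈
... | inj₁ x∈T = T , here refl , x∈T
... | inj₂ x∈P with ∈-allVerts⁻ P x∈P
...   | T′ , T′∈P , x∈T′ = T′ , there T′∈P , x∈T′

Unique-++⁻ʳ : ∀ {A : Set} (xs : List A) {ys} → Unique (xs ++ ys) → Unique ys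
Unique-++⁻ʳ [] u = u
Unique-++⁻ʳ (_ ∷ xs) (_ ∷ u) = Unique-++⁻ʳ xs u

Unique-++-disjoint : ∀ {A : Set} {xs ys : List A} {x} → Unique (xs ++ ys) → x ∈ xs → x ∉ ys
Unique-++-disjoint {xs = _ ∷ xs} (x≢ ∷ _) (here refl) x∈ys = All.lookup x≢ (∈-++⁺ʳ xs x∈ys) refl
Unique-++-disjoint (_ ∷ u) (there x∈xs) = Unique-++-disjoint u x∈xs

sharedVertex⇒≡ : ∀ {n} {P : List (Star n)} {T T′ x} → Unique (allVerts P) →
                 T ∈ P → T′ ∈ P → x ∈ verts T → x ∈ verts T′ → T ≡ T′
sharedVertex⇒≡ _ (here refl) (here refl) _ _ = refl
sharedVertex⇒≡ u (here refl) (there T′∈P) x∈T x∈T′ = ⊥-elim (Unique-++-disjoint u x∈T (∈-allVerts⁺ T′∈P x∈T′))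
sharedVertex⇒≡ u (there T∈P) (here refl) x∈T x∈T′ = ⊥-elim (Unique-++-disjoint u x∈T′ (∈-allVerts⁺ T∈P x∈T))
sharedVertex⇒≡ {P = T₀ ∷ _} u (there T∈P) (there T′∈P) = sharedVertex⇒≡ (Unique-++⁻ʳ (verts T₀) u) T∈P T′∈P

-- Used instead of `with` because the tests in `token` and `tokenStar` unfold in the goal.
if-does : ∀ {P A : Set} (B : A → Set) (d : Dec P) {x y : A} →
          (P → B x) → (¬ P → B y) → B (if does d then x else y)
if-does B (yes p) onYes onNo = onYes p
if-does B (no ¬p) onYes onNo = onNo ¬p

token≡tokenStar : ∀ {n k} {𝒮 Q : List (Star n)} {T v} → Unique (allVerts Q) →
                  T ∈ Q → v ∈ verts T → token k 𝒮 Q v ≡ tokenStar k 𝒮 T v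
token≡tokenStar {k = k} {𝒮} {T′ ∷ Q} {T} {v} u T∈ v∈T =
  if-does (_≡ tokenStar k 𝒮 T v) (v ∈? verts T′)
    (λ v∈T′ → cong (λ T → tokenStar k 𝒮 T v) (sharedVertex⇒≡ u (here refl) T∈ v∈T′ v∈T))
    (λ v∉T′ → elsewhere T∈ v∉T′)
  where
  elsewhere : T ∈ T′ ∷ Q → v ∉ verts T′ → token k 𝒮 Q v ≡ tokenStar k 𝒮 T v
  elsewhere (here refl) v∉T′ = ⊥-elim (v∉T′ v∈T)
  elsewhere (there T∈Q) _ = token≡tokenStar (Unique-++⁻ʳ (verts T′) u) T∈Q v∈T

-- Token rule (2) gives such a center 1 - (j - 1)α, the only token that can fall below minToken.
PoorCenter : ∀ {n} → List (Star n) → Star n → Fin n → Set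
PoorCenter 𝒮 T v = center T ≡ v × ¬ Critical 𝒮 v × Any (Critical 𝒮) (sats T)

minToken≤tokenStar : ∀ {n k} (𝒮 : List (Star n)) T v → 2 ≤ k → size T ≤ k →
                     ¬ PoorCenter 𝒮 T v → minToken k ℚ.≤ tokenStar k 𝒮 T v
minToken≤tokenStar 𝒮 (c -< [] >) v 2≤k _ _ = minToken≤α 2≤k
minToken≤tokenStar {k = k} 𝒮 (c -< s ∷ ss >) v 2≤k size≤k ¬poor =
  if-does bounded (critical? 𝒮 c)
    (λ _ → if-does bounded (c ≟ᶠ v)
      (λ _ → minToken≤α 2≤k)
      (λ _ → ℚP.*-monoˡ-≤-nonNeg (1ℚ - α k) {{1-α-nonNeg 2≤k}} (invℕ-antitone (s≤s z≤n) (ℕP.pred-mono-≤ size≤k))))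
    (λ c-uncritical → if-does bounded (Any.any? (critical? 𝒮) (s ∷ ss))
      (λ someCritical → if-does bounded (c ≟ᶠ v)
        (λ { refl → ⊥-elim (¬poor (refl , c-uncritical , someCritical)) })
        (λ _ → minToken≤α 2≤k))
      (λ _ → ℚP.≤-trans (minToken≤1/k 2≤k) (invℕ-antitone (s≤s z≤n) size≤k)))
  where
  bounded : ℚ → Set
  bounded = minToken k ℚ.≤_

tokenStar-criticalCenter : ∀ {n k} {𝒮 : List (Star n)} {c s ss} → Critical 𝒮 c →
                           tokenStar k 𝒮 (c -< s ∷ ss >) c ≡ α k
tokenStar-criticalCenter {k = k} {𝒮} {c} crit =
  if-does (_≡ α k) (critical? 𝒮 c)
    (λ _ → if-does (_≡ α k) (c ≟ᶠ c) (λ _ → refl) (λ c≢c → ⊥-elim (c≢c refl)))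
    (λ ¬crit → ⊥-elim (¬crit crit))

specialBound : ℕ → ℚ
specialBound k = (fromℕ 2 * α k) + (fromℕ 2 - fromℕ 2 * α k) * invℕ (k ∸ 1)

specialBound≡ : ∀ k → specialBound k ≡ minToken k + (minToken k + (α k + (α k + 0ℚ)))
specialBound≡ k =
  solve 2 (λ a i → ((con 1ℚ :+ con 1ℚ) :* a) :+ ((con 1ℚ :+ con 1ℚ) :- (con 1ℚ :+ con 1ℚ) :* a) :* i
                   := (con 1ℚ :- a) :* i :+ ((con 1ℚ :- a) :* i :+ (a :+ (a :+ con 0ℚ))))
          refl (α k) (invℕ (k ∸ 1))
  where open QSolver.+-*-Solver

QSatelliteOf : ∀ {n} → List (Star n) → Fin n → Fin n → Set
QSatelliteOf Q x y = Any (λ T → center T ≡ y × x ∈ sats T) Q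

module Partition {n} {G : Graph n} {k} {Q : List (Star n)} (isPartition : IsPartition G k Q) where

  unique : Unique (allVerts Q)
  unique = proj₁ (proj₂ isPartition)

  covers : ∀ v → v ∈ allVerts Q
  covers = proj₂ (proj₂ isPartition)

  size≤ : ∀ {T} → T ∈ Q → size T ≤ k
  size≤ T∈ = proj₂ (All.lookup (proj₁ isPartition) T∈)

  center∉sats : ∀ {T} → T ∈ Q → center T ∉ sats T
  center∉sats T∈ = proj₁ (proj₂ (proj₁ (All.lookup (proj₁ isPartition) T∈)))

  center-adj : ∀ {T x} → T ∈ Q → x ∈ sats T → Adj G (center T) x
  center-adj T∈ = All.lookup (proj₂ (proj₂ (proj₁ (All.lookup (proj₁ isPartition) T∈))))

  satellite⇒¬center : ∀ {T v} → QSatellite Q v → T ∈ Q → center T ≢ v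
  satellite⇒¬center {T} sat T∈ refl with find sat
  ... | T′ , T′∈ , v∈T′ with sharedVertex⇒≡ unique T∈ T′∈ (here refl) (there v∈T′)
  ...   | refl = center∉sats T∈ v∈T′

  QEdge⇒QSatelliteOf : ∀ {x y} → QSatellite Q x → QEdge Q x y → QSatelliteOf Q x y
  QEdge⇒QSatelliteOf sat edge with find edge
  ... | T , T∈ , inj₁ (c≡x , _) = ⊥-elim (satellite⇒¬center sat T∈ c≡x)
  ... | T , T∈ , inj₂ centeredAt-y = lose T∈ centeredAt-y

  QSatelliteOf⇒Adj : ∀ {x y} → QSatelliteOf Q x y → Adj G x y
  QSatelliteOf⇒Adj satOf with find satOf
  ... | T , T∈ , refl , x∈T = Graph.sym G (center-adj T∈ x∈T)

  token-criticalCenter : ∀ {𝒮 x c} → QSatelliteOf Q x c → Critical 𝒮 c → token k 𝒮 Q c ≡ α k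
  token-criticalCenter satOf crit with find satOf
  ... | (c -< s ∷ ss >) , T∈ , refl , _ =
    trans (token≡tokenStar unique T∈ (here refl)) (tokenStar-criticalCenter {k = k} {s = s} {ss} crit)

  minToken≤token : ∀ {𝒮 v} → 2 ≤ k → (∀ {T} → T ∈ Q → ¬ PoorCenter 𝒮 T v) → minToken k ℚ.≤ token k 𝒮 Q v
  minToken≤token {𝒮} {v} 2≤k ¬poor with ∈-allVerts⁻ Q (covers v)
  ... | T , T∈ , v∈T = subst (minToken k ℚ.≤_) (sym (token≡tokenStar unique T∈ v∈T))
                             (minToken≤tokenStar 𝒮 T v 2≤k (size≤ T∈) (¬poor T∈))

  minToken≤token-critical : ∀ {𝒮 v} → 2 ≤ k → Critical 𝒮 v → minToken k ℚ.≤ token k 𝒮 Q v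
  minToken≤token-critical 2≤k crit = minToken≤token 2≤k (λ _ (_ , ¬crit , _) → ¬crit crit)

  specialBound≤tokens-C4 : ∀ {𝒮 v₁ v₂ w₁ w₂} → 2 ≤ k →
    Critical 𝒮 v₁ → Critical 𝒮 v₂ → Critical 𝒮 w₁ → Critical 𝒮 w₂ →
    QSatelliteOf Q v₁ w₁ → QSatelliteOf Q v₂ w₂ →
    specialBound k ℚ.≤ sumℚ (map (token k 𝒮 Q) (v₁ ∷ v₂ ∷ w₁ ∷ w₂ ∷ []))
  specialBound≤tokens-C4 {𝒮} {v₁} {v₂} {w₁} {w₂} 2≤k v₁-crit v₂-crit w₁-crit w₂-crit sat₁ sat₂ = begin
    specialBound k                                   ≡⟨ specialBound≡ k ⟩
    minToken k + (minToken k + (α k + (α k + 0ℚ)))   ≤⟨ ℚP.+-mono-≤ (minToken≤token-critical 2≤k v₁-crit)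
                                                         (ℚP.+-mono-≤ (minToken≤token-critical 2≤k v₂-crit)
                                                         (ℚP.+-mono-≤ (ℚP.≤-reflexive (sym (token-criticalCenter sat₁ w₁-crit)))
                                                         (ℚP.+-mono-≤ (ℚP.≤-reflexive (sym (token-criticalCenter sat₂ w₂-crit)))
                                                         ℚP.≤-refl))) ⟩
    sumℚ (map (token k 𝒮 Q) (v₁ ∷ v₂ ∷ w₁ ∷ w₂ ∷ [])) ∎
    where
    open ℚP.≤-Reasoning

∈-2star⇒critical : ∀ {n} {𝒮 : List (Star n)} {T x} → T ∈ 𝒮 → size T ≡ 2 → x ∈ verts T → Critical 𝒮 x
∈-2star⇒critical T∈ size≡2 x∈T = lose T∈ (inj₁ (size≡2 , x∈T))

critical-∈-3star⇒center : ∀ {n} {𝒮 : List (Star n)} {W x} → Unique (allVerts 𝒮) →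
                          W ∈ 𝒮 → size W ≡ 3 → x ∈ verts W → Critical 𝒮 x → x ≡ center W
critical-∈-3star⇒center u W∈ size≡3 x∈W crit with find crit
... | T , T∈ , inj₂ (_ , refl) with sharedVertex⇒≡ u T∈ W∈ (here refl) x∈W
...   | refl = refl
critical-∈-3star⇒center u W∈ size≡3 x∈W crit | T , T∈ , inj₁ (size≡2 , x∈T) with sharedVertex⇒≡ u T∈ W∈ x∈T x∈W
...   | refl with trans (sym size≡2) size≡3
...     | ()

module _ {n} {G : Graph n} {𝒮 Q : List (Star n)}
         (P𝒮 : IsPartition G 4 𝒮) (PQ : IsPartition G 4 Q) (¬op3 : ¬Op3 G 4 𝒮) where
  private
    module 𝒮P = Partition {G = G} {4} {𝒮} P𝒮
    module QP = Partition {G = G} {4} {Q} PQ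

  3star-satellite-¬poor : ∀ {v₁ v₂ w u₁ u₂ u T} → (v₁ -< v₂ ∷ [] >) ∈ 𝒮 → (w -< u₁ ∷ u₂ ∷ [] >) ∈ 𝒮 →
                          QSatelliteOf Q v₁ w → QSatelliteOf Q v₂ w →
                          u ∈ u₁ ∷ u₂ ∷ [] → T ∈ Q → ¬ PoorCenter 𝒮 T u
  3star-satellite-¬poor {v₁} {v₂} {w} {u₁} {u₂} {T = T} S∈ W∈ sat₁ sat₂ u∈W T∈ (refl , _ , someCritical)
    with find someCritical
  ... | s , s∈T , s-critical =
    ¬op3 (W , S , v₂ , W∈ , inj₂ refl , S∈ , refl , (λ ()) ,
          QP.QSatelliteOf⇒Adj sat₁ , QP.QSatelliteOf⇒Adj sat₂ ,
          inj₂ (refl , refl , s , center T , s-critical , s∉W , s∉S , u∈W , Graph.sym G (QP.center-adj T∈ s∈T)))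
    where
    W S : Star n
    W = w -< u₁ ∷ u₂ ∷ [] >
    S = v₁ -< v₂ ∷ [] >
    -- A Q-star centered at w cannot contain s: it would be T, whose center is a satellite of W.
    apart : ∀ {x} → QSatelliteOf Q x w → s ≢ w × s ≢ x
    apart satOf with find satOf
    ... | T′ , T′∈ , T′-at-w , x∈T′ = (λ s≡w → at-w (here (trans s≡w (sym T′-at-w))))
                                    , (λ { refl → at-w (there x∈T′) })
      where
      at-w : s ∉ verts T′
      at-w s∈T′ = 𝒮P.center∉sats W∈ (subst (_∈ sats W) u≡w u∈W)
        where
        u≡w : center T ≡ w
        u≡w = trans (cong center (sharedVertex⇒≡ QP.unique T∈ T′∈ (there s∈T) s∈T′)) T′-at-w
    s∉W : s ∉ verts W
    s∉W (here s≡w) = proj₁ (apart sat₁) s≡w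
    s∉W (there s∈us) = proj₁ (apart sat₁) (critical-∈-3star⇒center 𝒮P.unique W∈ refl (there s∈us) s-critical)
    s∉S : s ∉ verts S
    s∉S (here s≡v₁) = proj₂ (apart sat₁) s≡v₁
    s∉S (there (here s≡v₂)) = proj₂ (apart sat₂) s≡v₂

  specialBound≤tokens-C3 : ∀ {v₁ v₂ W} → (v₁ -< v₂ ∷ [] >) ∈ 𝒮 → W ∈ 𝒮 → size W ≡ 3 →
                           QSatelliteOf Q v₁ (center W) → QSatelliteOf Q v₂ (center W) →
                           specialBound 4 ℚ.≤ sumℚ (map (token 4 𝒮 Q) (v₁ ∷ v₂ ∷ verts W))
  specialBound≤tokens-C3 {v₁} {v₂} {w -< u₁ ∷ u₂ ∷ [] >} S∈ W∈ refl sat₁ sat₂ = begin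
    specialBound 4
      ≤⟨ toWitness {a? = _ ℚ.≤? _} _ ⟩ -- 18/17 ≤ 4/17 + 4/17 + 5/17 + 4/17 + 4/17
    minToken 4 + (minToken 4 + (α 4 + (minToken 4 + (minToken 4 + 0ℚ))))
      ≤⟨ ℚP.+-mono-≤ (QP.minToken≤token-critical 2≤4 (∈-2star⇒critical S∈ refl (here refl)))
        (ℚP.+-mono-≤ (QP.minToken≤token-critical 2≤4 (∈-2star⇒critical S∈ refl (there (here refl))))
        (ℚP.+-mono-≤ (ℚP.≤-reflexive (sym (QP.token-criticalCenter sat₁ (lose W∈ (inj₂ (refl , refl))))))
        (ℚP.+-mono-≤ (satellite-bound (here refl))
        (ℚP.+-mono-≤ (satellite-bound (there (here refl)))
        ℚP.≤-refl)))) ⟩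
    sumℚ (map (token 4 𝒮 Q) (v₁ ∷ v₂ ∷ w ∷ u₁ ∷ u₂ ∷ []))
      ∎
    where
    open ℚP.≤-Reasoning
    2≤4 : 2 ≤ 4
    2≤4 = s≤s (s≤s z≤n)
    satellite-bound : ∀ {u} → u ∈ u₁ ∷ u₂ ∷ [] → minToken 4 ℚ.≤ token 4 𝒮 Q u
    satellite-bound u∈W = QP.minToken≤token 2≤4 (3star-satellite-¬poor S∈ W∈ sat₁ sat₂ u∈W)
  specialBound≤tokens-C3 {W = _ -< [] >} _ _ ()
  specialBound≤tokens-C3 {W = _ -< _ ∷ [] >} _ _ ()
  specialBound≤tokens-C3 {W = _ -< _ ∷ _ ∷ _ ∷ _ >} _ _ ()

lemma9 : (n k : ℕ) → 4 ≤ k → (G : Graph n) → (𝒮 Q : List (Star n)) →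
    IsPartition G k 𝒮 → MinOnes G k 𝒮 →
    ¬Op1 G 𝒮 → ¬Op2 G 𝒮 → ¬Op3 G k 𝒮 →
    IsPartition G k Q → Optimal G k Q →
    (S W : Star n) → Special2WithAssoc k 𝒮 Q S W →
    (fromℕ 2 * α k) + (fromℕ 2 - fromℕ 2 * α k) * invℕ (k ∸ 1)
      ℚ.≤ sumℚ (map (token k 𝒮 Q) (verts S ++ verts W))
lemma9 n k 4≤k G 𝒮 Q _ _ _ _ _ PQ _ (v₁ -< _ >) (w₁ -< _ >)
       (v₂ , S∈ , refl , sat₁ , sat₂ , W∈ , inj₂ (w₂ , refl , e₁ , e₂)) =
  QP.specialBound≤tokens-C4 (ℕP.≤-trans (s≤s (s≤s z≤n)) 4≤k)
    (∈-2star⇒critical S∈ refl (here refl)) (∈-2star⇒critical S∈ refl (there (here refl)))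
    (∈-2star⇒critical W∈ refl (here refl)) (∈-2star⇒critical W∈ refl (there (here refl)))
    (QP.QEdge⇒QSatelliteOf sat₁ e₁) (QP.QEdge⇒QSatelliteOf sat₂ e₂)
  where module QP = Partition {G = G} {k} {Q} PQ
lemma9 n _ _ G 𝒮 Q P𝒮 _ _ _ ¬op3 PQ _ (v₁ -< _ >) W
       (v₂ , S∈ , refl , sat₁ , sat₂ , W∈ , inj₁ (refl , size≡3 , e₁ , e₂)) =
  specialBound≤tokens-C3 {G = G} {𝒮} {Q} P𝒮 PQ ¬op3 S∈ W∈ size≡3
    (QP.QEdge⇒QSatelliteOf sat₁ e₁) (QP.QEdge⇒QSatelliteOf sat₂ e₂)
  where module QP = Partition {G = G} {4} {Q} PQ
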